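{- Let $n$ be a positive integer and $g(z)=(1-z)^{b-1}z^{n-b}$. For every integer $1\leq b\leq n$, $$p_{b,n} = \frac{\int_0^{1-b/n}(1-z)^{b-1}z^{n-b}\,dz}{\int_0^1(1-z)^{b-1}z^{n-b}\,dz},\qquad z_{b,n} =\frac{\frac{1}{2}b\left(\int_{1-b/n}^1g(z)\,dz-\int_{0}^{1-b/n}g(z)\,dz\right)}{(b/n)^b(1-b/n)^{n-b}}.$$ Moreover, for every integer $1\leq b\leq n-1$, $$p_{b+1,n}-p_{b,n}=\frac{\left(\frac{b+1}{n}\right)^b\left(1-\frac{b+1}{n}\right)^{n-b}-b\int_{1-(b+1)/n}^{1-b/n}(1-z)^{b-1} z^{n-b}\,dz}{b\int_0^1(1-z)^{b-1}z^{n-b}\,dz},$$ and $$z_{b+1,n}-z_{b,n}=\frac{n^{n}}{2(n-b)(b+1)^b(n-b-1)^{n-b-1}}\Biggl(-2\left(\frac{b+1}{n}\right)^b\left(\frac{n-b-1}{n}\right)^{n-b}+b\left[\int_{1-(b+1)/n}^1g(z)\,dz-\int_{0}^{1-(b+1)/n}g(z)\,dz\right]$$ $$-\,b\left(1+\frac{1}{b}\right)^b\left(1-\frac{1}{n-b}\right)^{n-b-1}\left[\int_{1-b/n}^1g(z)\,dz-\int_{0}^{1-b/n}g(z)\,dz\right]\Biggr),$$ where $g(z)=(1-z)^{b-1}z^{n-b}$ (with the same $b$ throughout).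
   Context: For positive integers $b\leq n$, let $\xi_{b,n}$ be a binomial random variable with parameters $n$ and $b/n$, $p_{b,n}:={\sf P}(\xi_{b,n}<b)$, and $z_{b,n}:=\frac{\frac{1}{2}-{\sf P}(\xi_{b,n}<b)}{{\sf P}(\xi_{b,n}=b)}$. The convention $0^0=1$ is used. -}

module Defs where

open import Data.Nat as ℕ using (ℕ; zero; suc)
open import Data.Nat.Combinatorics using (_C_)
open import Data.Integer using (+_)
open import Data.Rational using (ℚ; 0ℚ; 1ℚ; _+_; _*_; _-_; -_; _÷_; _/_)
open import Data.Rational.Properties using (_≟_)
open import Data.Rational.Base using (≢-nonZero)
open import Data.List using (List; []; _∷_)
open import Relation.Nullary using (yes; no)

ℕ→ℚ : ℕ → ℚ
ℕ→ℚ k = (+ k) / 1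

-- power with natural exponent (so 0 ^ 0 = 1, the paper's convention)
infixr 8 _^_
_^_ : ℚ → ℕ → ℚ
x ^ zero  = 1ℚ
x ^ suc k = x * (x ^ k)

-- total division; only ever applied to nonzero denominators below
-- (returns 0 on a zero denominator, a case that never arises here)
infixl 7 _//_
_//_ : ℚ → ℚ → ℚ
p // q with q ≟ 0ℚ
... | yes _  = 0ℚ
... | no q≢0 = _÷_ p q {{≢-nonZero q≢0}}

Σ< : ℕ → (ℕ → ℚ) → ℚ
Σ< zero    f = 0ℚ
Σ< (suc m) f = Σ< m f + f m

-- P(ξ_{b,n} = k) = C(n,k) (b/n)^k (1 - b/n)^(n-k)
binomPMF : ℕ → ℕ → ℕ → ℚ
binomPMF b n k =
  ℕ→ℚ (n C k) * ((ℕ→ℚ b // ℕ→ℚ n) ^ k)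
              * ((1ℚ - ℕ→ℚ b // ℕ→ℚ n) ^ (n ℕ.∸ k))

-- p_{b,n} = P(ξ_{b,n} < b)
pbn : ℕ → ℕ → ℚ
pbn b n = Σ< b (binomPMF b n)

-- z_{b,n} = (1/2 - P(ξ_{b,n} < b)) / P(ξ_{b,n} = b)
zbn : ℕ → ℕ → ℚ
zbn b n = ((1ℚ // ℕ→ℚ 2) - pbn b n) // binomPMF b n b

-- Polynomials over ℚ (coefficient lists, lowest degree first)
-- and their definite integrals.

Poly : Set
Poly = List ℚ

addP : Poly → Poly → Poly
addP []       q        = q
addP (a ∷ p)  []       = a ∷ p
addP (a ∷ p)  (b ∷ q)  = (a + b) ∷ addP p q

scaleP : ℚ → Poly → Poly
scaleP c []      = []
scaleP c (a ∷ p) = (c * a) ∷ scaleP c p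

mulP : Poly → Poly → Poly
mulP []      q = []
mulP (a ∷ p) q = addP (scaleP a q) (0ℚ ∷ mulP p q)

powP : Poly → ℕ → Poly
powP p zero    = 1ℚ ∷ []
powP p (suc k) = mulP p (powP p k)

evalP : Poly → ℚ → ℚ
evalP []      x = 0ℚ
evalP (a ∷ p) x = a + x * evalP p x

Z : Poly
Z = 0ℚ ∷ 1ℚ ∷ []

oneMinusZ : Poly
oneMinusZ = 1ℚ ∷ (- 1ℚ) ∷ []

antiderivFrom : ℕ → Poly → Poly
antiderivFrom i []      = []
antiderivFrom i (a ∷ p) = (a // ℕ→ℚ (suc i)) ∷ antiderivFrom (suc i) p

antideriv : Poly → Poly
antideriv p = 0ℚ ∷ antiderivFrom 0 p

∫ : Poly → ℚ → ℚ → ℚ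
∫ p lo hi = evalP (antideriv p) hi - evalP (antideriv p) lo

gPoly : ℕ → ℕ → Poly
gPoly b n = mulP (powP oneMinusZ (b ℕ.∸ 1)) (powP Z (n ℕ.∸ b))

{-# OPTIONS --safe #-}
-- The core is the beta-binomial identity: for n = k + 1 + m,
--   P(Bin(n, q) ≤ k) = (k+1) C(n,k+1) ∫₀^{1-q} (1-z)^k z^m dz,
-- proved by induction on k.  The inductive step is integration by parts,
--   d/dz [(1-z)^k z^{m+1}] = (m+1) (1-z)^k z^m - k (1-z)^{k-1} z^{m+1},
-- which is checked on the coefficient sequences of the polynomials, where
-- multiplication by z is a shift.  At q = 0 the left side is 1, so the
-- constant (k+1) C(n,k+1) is 1 / ∫₀¹ g; this gives the formula for p_{b,n}.
-- The remaining identities are rational algebra, using the absorption identity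
-- (n-b) C(n,b) = (b+1) C(n,b+1) and the mode weight
-- (c/n)^c (1-c/n)^(n-c) n^n = c^c (n-c)^(n-c).
module Submission where

open import Defs
open import Data.Nat as ℕ using (ℕ; suc; _≤_)
open import Data.Product using (_×_)
open import Relation.Binary.PropositionalEquality using (_≡_)
open import Data.Rational using (ℚ; 0ℚ; 1ℚ; _+_; _*_; _-_)

open import Data.Nat using (zero; z≤n; s≤s)
import Data.Nat.Properties as ℕ
open import Data.Nat.Coprimality using (1-coprimeTo) renaming (sym to coprime-sym)
open import Data.Nat.Combinatorics using (_C_; nCk+nC[k+1]≡[n+1]C[k+1]; k>n⇒nCk≡0; nC1≡n)
import Data.Integer as ℤ hiding (+_)
open import Data.Integer using () renaming (+_ to pos)
import Data.Integer.Properties as ℤ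
open import Data.List using ([]; _∷_)
open import Data.Product using (_,_)
open import Data.Rational using (-_; mkℚ; _/_; _÷_; 1/_)
open import Data.Rational.Base using (≢-nonZero)
open import Data.Rational.Properties
  using ( normalize-coprime; _≟_; +-identityˡ; +-identityʳ; +-inverseʳ
        ; *-zeroˡ; *-zeroʳ; *-identityˡ; *-identityʳ; *-inverseˡ; *-inverseʳ; *-comm; *-assoc)
open import Data.Rational.Solver using (module +-*-Solver)
open import Data.Empty using (⊥-elim)
open import Relation.Binary.PropositionalEquality
  using (_≢_; _≗_; refl; sym; trans; cong; cong₂; subst; module ≡-Reasoning)
open import Relation.Nullary using (Dec; yes; no)

open +-*-Solver
open ≡-Reasoning

ℕ→ℚ≡mkℚ : ∀ k → ℕ→ℚ k ≡ mkℚ (pos k) 0 (coprime-sym (1-coprimeTo k))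
ℕ→ℚ≡mkℚ k = normalize-coprime _

ℕ→ℚ-homo-+ : ∀ a b → ℕ→ℚ (a ℕ.+ b) ≡ ℕ→ℚ a + ℕ→ℚ b
ℕ→ℚ-homo-+ a b = begin
  pos (a ℕ.+ b) / 1                          ≡⟨ cong (_/ 1) numerator ⟩
  (pos a ℤ.* pos 1 ℤ.+ pos b ℤ.* pos 1) / 1  ≡⟨ sym (cong₂ _+_ (ℕ→ℚ≡mkℚ a) (ℕ→ℚ≡mkℚ b)) ⟩
  ℕ→ℚ a + ℕ→ℚ b                              ∎
  where
  numerator : pos (a ℕ.+ b) ≡ pos a ℤ.* pos 1 ℤ.+ pos b ℤ.* pos 1
  numerator = trans (ℤ.pos-+ a b)
    (sym (cong₂ ℤ._+_ (ℤ.*-identityʳ (pos a)) (ℤ.*-identityʳ (pos b))))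

ℕ→ℚ-homo-* : ∀ a b → ℕ→ℚ (a ℕ.* b) ≡ ℕ→ℚ a * ℕ→ℚ b
ℕ→ℚ-homo-* a b = begin
  pos (a ℕ.* b) / 1        ≡⟨ cong (_/ 1) (ℤ.pos-* a b) ⟩
  (pos a ℤ.* pos b) / 1    ≡⟨ sym (cong₂ _*_ (ℕ→ℚ≡mkℚ a) (ℕ→ℚ≡mkℚ b)) ⟩
  ℕ→ℚ a * ℕ→ℚ b            ∎

ℕ→ℚ-homo-∸ : ∀ {a c} → c ≤ a → ℕ→ℚ (a ℕ.∸ c) ≡ ℕ→ℚ a - ℕ→ℚ c
ℕ→ℚ-homo-∸ {a} {c} c≤a = begin
  ℕ→ℚ (a ℕ.∸ c)                     ≡⟨ solve 2 (λ d c → d := (d :+ c) :- c) refl (ℕ→ℚ (a ℕ.∸ c)) (ℕ→ℚ c) ⟩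
  (ℕ→ℚ (a ℕ.∸ c) + ℕ→ℚ c) - ℕ→ℚ c  ≡⟨ cong (_- ℕ→ℚ c) (sym (ℕ→ℚ-homo-+ (a ℕ.∸ c) c)) ⟩
  ℕ→ℚ (a ℕ.∸ c ℕ.+ c) - ℕ→ℚ c       ≡⟨ cong (λ t → ℕ→ℚ t - ℕ→ℚ c) (ℕ.m∸n+n≡m c≤a) ⟩
  ℕ→ℚ a - ℕ→ℚ c                     ∎

ℕ→ℚ[1+n]≢0 : ∀ k → ℕ→ℚ (suc k) ≢ 0ℚ
ℕ→ℚ[1+n]≢0 k eq with trans (sym (ℕ→ℚ≡mkℚ (suc k))) eq
... | ()

1≢0 : 1ℚ ≢ 0ℚ
1≢0 ()

p//0≡0 : ∀ {p q} → q ≡ 0ℚ → p // q ≡ 0ℚ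
p//0≡0 refl = refl

module _ {q : ℚ} (q≢0 : q ≢ 0ℚ) where
  private instance
    q-nonZero = ≢-nonZero q≢0

  p//q≡p÷q : ∀ p → p // q ≡ p ÷ q
  p//q≡p÷q p with q ≟ 0ℚ
  ... | yes q≡0 = ⊥-elim (q≢0 q≡0)
  ... | no _    = refl

  p//q*q≡p : ∀ p → (p // q) * q ≡ p
  p//q*q≡p p = begin
    (p // q) * q    ≡⟨ cong (_* q) (p//q≡p÷q p) ⟩
    p * 1/ q * q    ≡⟨ *-assoc p (1/ q) q ⟩
    p * (1/ q * q)  ≡⟨ cong (p *_) (*-inverseˡ q) ⟩
    p * 1ℚ          ≡⟨ *-identityʳ p ⟩
    p               ∎

  *-cancelʳ : ∀ {p r} → p * q ≡ r * q → p ≡ r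
  *-cancelʳ {p} {r} eq = trans (sym (p*q*1/q≡p p)) (trans (cong (_* 1/ q) eq) (p*q*1/q≡p r))
    where
    p*q*1/q≡p : ∀ p → p * q * 1/ q ≡ p
    p*q*1/q≡p p = trans (*-assoc p q (1/ q)) (trans (cong (p *_) (*-inverseʳ q)) (*-identityʳ p))

  p≡r*q⇒p//q≡r : ∀ {p r} → p ≡ r * q → p // q ≡ r
  p≡r*q⇒p//q≡r eq = *-cancelʳ (trans (p//q*q≡p _) eq)

  //-distribʳ-+ : ∀ p r → (p + r) // q ≡ p // q + r // q
  //-distribʳ-+ p r = p≡r*q⇒p//q≡r (begin
    p + r
      ≡⟨ sym (cong₂ _+_ (p//q*q≡p p) (p//q*q≡p r)) ⟩
    (p // q) * q + (r // q) * q
      ≡⟨ solve 3 (λ x y q → x :* q :+ y :* q := (x :+ y) :* q) refl (p // q) (r // q) q ⟩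
    (p // q + r // q) * q ∎)

  *-//-assoc : ∀ c p → (c * p) // q ≡ c * (p // q)
  *-//-assoc c p = p≡r*q⇒p//q≡r (begin
    c * p               ≡⟨ cong (c *_) (sym (p//q*q≡p p)) ⟩
    c * ((p // q) * q)  ≡⟨ sym (*-assoc c (p // q) q) ⟩
    c * (p // q) * q    ∎)

p*q≢0 : ∀ {p q} → p ≢ 0ℚ → q ≢ 0ℚ → p * q ≢ 0ℚ
p*q≢0 {p} {q} p≢0 q≢0 pq≡0 = q≢0 (*-cancelʳ p≢0 (trans (*-comm q p) (trans pq≡0 (sym (*-zeroˡ p)))))

p*q≢0⇒p≢0 : ∀ {p q} → p * q ≢ 0ℚ → p ≢ 0ℚ
p*q≢0⇒p≢0 {p} {q} pq≢0 refl = pq≢0 (*-zeroˡ q)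

p*q≢0⇒q≢0 : ∀ {p q} → p * q ≢ 0ℚ → q ≢ 0ℚ
p*q≢0⇒q≢0 {p} {q} pq≢0 refl = pq≢0 (*-zeroʳ p)

p^n≢0 : ∀ {p} n → p ≢ 0ℚ → p ^ n ≢ 0ℚ
p^n≢0 zero    p≢0 = 1≢0
p^n≢0 (suc n) p≢0 = p*q≢0 p≢0 (p^n≢0 n p≢0)

-- No hypothesis on q: for q = 0 both sides are 0 by the convention for _//_.
c*p//c*q≡p//q : ∀ {c} → c ≢ 0ℚ → ∀ p q → (c * p) // (c * q) ≡ p // q
c*p//c*q≡p//q {c} c≢0 p q = by-cases (q ≟ 0ℚ)
  where
  by-cases : Dec (q ≡ 0ℚ) → (c * p) // (c * q) ≡ p // q
  by-cases (yes q≡0) = trans (p//0≡0 (trans (cong (c *_) q≡0) (*-zeroʳ c))) (sym (p//0≡0 q≡0))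
  by-cases (no q≢0)  = p≡r*q⇒p//q≡r (p*q≢0 c≢0 q≢0) (begin
    c * p                  ≡⟨ cong (c *_) (sym (p//q*q≡p q≢0 p)) ⟩
    c * ((p // q) * q)     ≡⟨ solve 3 (λ c r q → c :* (r :* q) := r :* (c :* q)) refl c (p // q) q ⟩
    (p // q) * (c * q)     ∎)

p*q≡1⇒r//q≡r*p : ∀ {p q} → p * q ≡ 1ℚ → ∀ r → r // q ≡ r * p
p*q≡1⇒r//q≡r*p {p} {q} pq≡1 r = p≡r*q⇒p//q≡r q≢0 (begin
  r                ≡⟨ sym (*-identityʳ r) ⟩
  r * 1ℚ           ≡⟨ cong (r *_) (sym pq≡1) ⟩
  r * (p * q)      ≡⟨ sym (*-assoc r p q) ⟩
  r * p * q        ∎)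
  where
  q≢0 : q ≢ 0ℚ
  q≢0 = p*q≢0⇒q≢0 {p} (λ pq≡0 → 1≢0 (trans (sym pq≡1) pq≡0))

^-distribˡ-+-* : ∀ p i j → p ^ (i ℕ.+ j) ≡ p ^ i * p ^ j
^-distribˡ-+-* p zero    j = sym (*-identityˡ _)
^-distribˡ-+-* p (suc i) j = trans (cong (p *_) (^-distribˡ-+-* p i j)) (sym (*-assoc p _ _))

^-distribʳ-* : ∀ p q i → (p * q) ^ i ≡ p ^ i * q ^ i
^-distribʳ-* p q zero    = refl
^-distribʳ-* p q (suc i) = begin
  p * q * (p * q) ^ i
    ≡⟨ cong (p * q *_) (^-distribʳ-* p q i) ⟩
  p * q * (p ^ i * q ^ i)
    ≡⟨ solve 4 (λ p q x y → p :* q :* (x :* y) := p :* x :* (q :* y)) refl p q (p ^ i) (q ^ i) ⟩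
  p * p ^ i * (q * q ^ i) ∎

^-zeroˡ : ∀ n → 1ℚ ^ n ≡ 1ℚ
^-zeroˡ zero    = refl
^-zeroˡ (suc n) = trans (cong (1ℚ *_) (^-zeroˡ n)) (*-identityˡ 1ℚ)

p*c≡u⇒p^n*c^n≡u^n : ∀ {p c u} n → p * c ≡ u → p ^ n * c ^ n ≡ u ^ n
p*c≡u⇒p^n*c^n≡u^n {p} {c} n eq = trans (sym (^-distribʳ-* p c n)) (cong (_^ n) eq)

coef : Poly → ℕ → ℚ
coef []      _       = 0ℚ
coef (a ∷ p) zero    = a
coef (a ∷ p) (suc i) = coef p i

-- shift is multiplication by z and deriv is the formal derivative.
shift : (ℕ → ℚ) → ℕ → ℚ
shift f zero    = 0ℚ
shift f (suc i) = f i

shiftBy : ℕ → (ℕ → ℚ) → ℕ → ℚ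
shiftBy zero    f = f
shiftBy (suc m) f = shift (shiftBy m f)

deriv : (ℕ → ℚ) → ℕ → ℚ
deriv f i = ℕ→ℚ (suc i) * f (suc i)

shift-cong : ∀ {f g} → f ≗ g → shift f ≗ shift g
shift-cong f≗g zero    = refl
shift-cong f≗g (suc i) = f≗g i

shift-+ : ∀ f g i → shift (λ j → f j + g j) i ≡ shift f i + shift g i
shift-+ f g zero    = sym (+-identityˡ 0ℚ)
shift-+ f g (suc i) = refl

shift-scale : ∀ c f i → shift (λ j → c * f j) i ≡ c * shift f i
shift-scale c f zero    = sym (*-zeroʳ c)
shift-scale c f (suc i) = refl

shift-0 : shift (λ _ → 0ℚ) ≗ (λ _ → 0ℚ)
shift-0 zero    = refl
shift-0 (suc i) = refl

shiftBy-cong : ∀ m {f g} → f ≗ g → shiftBy m f ≗ shiftBy m g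
shiftBy-cong zero    f≗g = f≗g
shiftBy-cong (suc m) f≗g = shift-cong (shiftBy-cong m f≗g)

shiftBy-scale : ∀ m c f i → shiftBy m (λ j → c * f j) i ≡ c * shiftBy m f i
shiftBy-scale zero    c f i = refl
shiftBy-scale (suc m) c f i =
  trans (shift-cong (shiftBy-scale m c f) i) (shift-scale c (shiftBy m f) i)

deriv-cong : ∀ {f g} → f ≗ g → deriv f ≗ deriv g
deriv-cong f≗g i = cong (ℕ→ℚ (suc i) *_) (f≗g (suc i))

deriv-shift : ∀ f i → deriv (shift f) i ≡ f i + shift (deriv f) i
deriv-shift f zero    = solve 1 (λ x → con 1ℚ :* x := x :+ con 0ℚ) refl (f 0)
deriv-shift f (suc i) = begin
  ℕ→ℚ (suc (suc i)) * f (suc i)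
    ≡⟨ cong (_* f (suc i)) (ℕ→ℚ-homo-+ 1 (suc i)) ⟩
  (1ℚ + ℕ→ℚ (suc i)) * f (suc i)
    ≡⟨ solve 2 (λ n x → (con 1ℚ :+ n) :* x := x :+ n :* x) refl (ℕ→ℚ (suc i)) (f (suc i)) ⟩
  f (suc i) + ℕ→ℚ (suc i) * f (suc i) ∎

deriv-shiftBy : ∀ m f i →
  deriv (shiftBy (suc m) f) i ≡ ℕ→ℚ (suc m) * shiftBy m f i + shiftBy (suc m) (deriv f) i
deriv-shiftBy zero    f i = trans (deriv-shift f i) (cong (_+ shift (deriv f) i) (sym (*-identityˡ (f i))))
deriv-shiftBy (suc m) f i = begin
  deriv (shift (shiftBy (suc m) f)) i
    ≡⟨ deriv-shift (shiftBy (suc m) f) i ⟩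
  F i + shift (deriv (shiftBy (suc m) f)) i
    ≡⟨ cong (F i +_) (shift-cong (deriv-shiftBy m f) i) ⟩
  F i + shift (λ j → ℕ→ℚ (suc m) * shiftBy m f j + G j) i
    ≡⟨ cong (F i +_) (shift-+ (λ j → ℕ→ℚ (suc m) * shiftBy m f j) G i) ⟩
  F i + (shift (λ j → ℕ→ℚ (suc m) * shiftBy m f j) i + shift G i)
    ≡⟨ cong (λ t → F i + (t + shift G i)) (shift-scale (ℕ→ℚ (suc m)) (shiftBy m f) i) ⟩
  F i + (ℕ→ℚ (suc m) * F i + shift G i)
    ≡⟨ solve 3 (λ x n y → x :+ (n :* x :+ y) := (con 1ℚ :+ n) :* x :+ y) refl (F i) (ℕ→ℚ (suc m)) (shift G i) ⟩
  (1ℚ + ℕ→ℚ (suc m)) * F i + shift G i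
    ≡⟨ cong (λ t → t * F i + shift G i) (sym (ℕ→ℚ-homo-+ 1 (suc m))) ⟩
  ℕ→ℚ (suc (suc m)) * F i + shift G i ∎
  where
  F = shiftBy (suc m) f
  G = shiftBy (suc m) (deriv f)

coef-addP : ∀ p q i → coef (addP p q) i ≡ coef p i + coef q i
coef-addP []      q       i       = sym (+-identityˡ (coef q i))
coef-addP (a ∷ p) []      i       = sym (+-identityʳ (coef (a ∷ p) i))
coef-addP (a ∷ p) (b ∷ q) zero    = refl
coef-addP (a ∷ p) (b ∷ q) (suc i) = coef-addP p q i

coef-scaleP : ∀ c p i → coef (scaleP c p) i ≡ c * coef p i
coef-scaleP c []      i       = sym (*-zeroʳ c)
coef-scaleP c (a ∷ p) zero    = refl
coef-scaleP c (a ∷ p) (suc i) = coef-scaleP c p i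

coef-0∷ : ∀ p → coef (0ℚ ∷ p) ≗ shift (coef p)
coef-0∷ p zero    = refl
coef-0∷ p (suc i) = refl

coef-mulP-∷ : ∀ a p q i → coef (mulP (a ∷ p) q) i ≡ a * coef q i + shift (coef (mulP p q)) i
coef-mulP-∷ a p q i = trans (coef-addP (scaleP a q) (0ℚ ∷ mulP p q) i)
  (cong₂ _+_ (coef-scaleP a q i) (coef-0∷ (mulP p q) i))

coef-[c]* : ∀ c q i → coef (mulP (c ∷ []) q) i ≡ c * coef q i
coef-[c]* c q i = trans (coef-mulP-∷ c [] q i) (trans (cong (c * coef q i +_) (shift-0 i)) (+-identityʳ _))

coef-[a+cz]* : ∀ a c q i → coef (mulP (a ∷ c ∷ []) q) i ≡ a * coef q i + c * shift (coef q) i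
coef-[a+cz]* a c q i = begin
  coef (mulP (a ∷ c ∷ []) q) i
    ≡⟨ coef-mulP-∷ a (c ∷ []) q i ⟩
  a * coef q i + shift (coef (mulP (c ∷ []) q)) i
    ≡⟨ cong (a * coef q i +_) (shift-cong (coef-[c]* c q) i) ⟩
  a * coef q i + shift (λ j → c * coef q j) i
    ≡⟨ cong (a * coef q i +_) (shift-scale c (coef q) i) ⟩
  a * coef q i + c * shift (coef q) i ∎

coef-Z* : ∀ q i → coef (mulP Z q) i ≡ shift (coef q) i
coef-Z* q i = trans (coef-[a+cz]* 0ℚ 1ℚ q i)
  (solve 2 (λ x y → con 0ℚ :* x :+ con 1ℚ :* y := y) refl (coef q i) (shift (coef q) i))

coef-[1-z]* : ∀ q i → coef (mulP oneMinusZ q) i ≡ coef q i - shift (coef q) i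
coef-[1-z]* q i = trans (coef-[a+cz]* 1ℚ (- 1ℚ) q i)
  (solve 2 (λ x y → con 1ℚ :* x :+ (:- con 1ℚ) :* y := x :- y) refl (coef q i) (shift (coef q) i))

coef-mulP-1ʳ : ∀ p → coef (mulP p (1ℚ ∷ [])) ≗ coef p
coef-mulP-1ʳ []      i       = refl
coef-mulP-1ʳ (a ∷ p) zero    = trans (coef-mulP-∷ a p (1ℚ ∷ []) 0)
  (solve 1 (λ a → a :* con 1ℚ :+ con 0ℚ := a) refl a)
coef-mulP-1ʳ (a ∷ p) (suc i) = begin
  coef (mulP (a ∷ p) (1ℚ ∷ [])) (suc i)     ≡⟨ coef-mulP-∷ a p (1ℚ ∷ []) (suc i) ⟩
  a * 0ℚ + coef (mulP p (1ℚ ∷ [])) i         ≡⟨ cong (a * 0ℚ +_) (coef-mulP-1ʳ p i) ⟩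
  a * 0ℚ + coef p i                          ≡⟨ solve 2 (λ a x → a :* con 0ℚ :+ x := x) refl a (coef p i) ⟩
  coef p i                                   ∎

coef-mulP-shiftʳ : ∀ p {q r} → coef r ≗ shift (coef q) → coef (mulP p r) ≗ shift (coef (mulP p q))
coef-mulP-shiftʳ []      r≗zq i = sym (shift-0 i)
coef-mulP-shiftʳ (a ∷ p) {q} {r} r≗zq i = begin
  coef (mulP (a ∷ p) r) i
    ≡⟨ coef-mulP-∷ a p r i ⟩
  a * coef r i + shift (coef (mulP p r)) i
    ≡⟨ cong₂ (λ u v → a * u + v) (r≗zq i) (shift-cong (coef-mulP-shiftʳ p r≗zq) i) ⟩
  a * shift (coef q) i + shift (shift (coef (mulP p q))) i
    ≡⟨ cong (_+ shift (shift (coef (mulP p q))) i) (sym (shift-scale a (coef q) i)) ⟩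
  shift (λ j → a * coef q j) i + shift (shift (coef (mulP p q))) i
    ≡⟨ sym (shift-+ (λ j → a * coef q j) (shift (coef (mulP p q))) i) ⟩
  shift (λ j → a * coef q j + shift (coef (mulP p q)) j) i
    ≡⟨ shift-cong (λ j → sym (coef-mulP-∷ a p q j)) i ⟩
  shift (coef (mulP (a ∷ p) q)) i ∎

betaPoly : ℕ → ℕ → Poly
betaPoly k m = mulP (powP oneMinusZ k) (powP Z m)

coef-betaPoly : ∀ k m → coef (betaPoly k m) ≗ shiftBy m (coef (powP oneMinusZ k))
coef-betaPoly k zero    = coef-mulP-1ʳ (powP oneMinusZ k)
coef-betaPoly k (suc m) i = trans (coef-mulP-shiftʳ (powP oneMinusZ k) (coef-Z* (powP Z m)) i)
  (shift-cong (coef-betaPoly k m) i)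

-- With k ∸ 1, the case k = 0 (where the right-hand side vanishes) needs no separate statement.
deriv-[1-z]^ : ∀ k → deriv (coef (powP oneMinusZ k)) ≗ (λ j → - ℕ→ℚ k * coef (powP oneMinusZ (k ℕ.∸ 1)) j)
deriv-[1-z]^ zero    j = solve 2 (λ n x → n :* con 0ℚ := (:- con 0ℚ) :* x) refl (ℕ→ℚ (suc j)) (coef (1ℚ ∷ []) j)
deriv-[1-z]^ (suc k) j = begin
  deriv (coef (mulP oneMinusZ (powP oneMinusZ k))) j
    ≡⟨ deriv-cong (coef-[1-z]* (powP oneMinusZ k)) j ⟩
  ℕ→ℚ (suc j) * (B (suc j) - B j)
    ≡⟨ solve 3 (λ n x y → n :* (x :- y) := n :* x :- n :* y) refl (ℕ→ℚ (suc j)) (B (suc j)) (B j) ⟩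
  deriv B j - deriv (shift B) j
    ≡⟨ cong (λ t → deriv B j - t) (deriv-shift B j) ⟩
  deriv B j - (B j + shift (deriv B) j)
    ≡⟨ cong₂ (λ u v → u - (B j + v)) (deriv-[1-z]^ k j)
             (trans (shift-cong (deriv-[1-z]^ k) j) (shift-scale (- n) B′ j)) ⟩
  - n * B′ j - (B j + - n * shift B′ j)
    ≡⟨ solve 4 (λ n x y z → :- n :* x :- (z :+ :- n :* y) := :- (n :* (x :- y)) :- z)
             refl n (B′ j) (shift B′ j) (B j) ⟩
  - (n * (B′ j - shift B′ j)) - B j
    ≡⟨ cong (λ t → - t - B j) (absorb k) ⟩
  - (n * B j) - B j
    ≡⟨ solve 2 (λ n x → :- (n :* x) :- x := :- (con 1ℚ :+ n) :* x) refl n (B j) ⟩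
  - (1ℚ + n) * B j
    ≡⟨ cong (λ t → - t * B j) (sym (ℕ→ℚ-homo-+ 1 k)) ⟩
  - ℕ→ℚ (suc k) * B j ∎
  where
  n  = ℕ→ℚ k
  B  = coef (powP oneMinusZ k)
  B′ = coef (powP oneMinusZ (k ℕ.∸ 1))
  B₀ = coef (powP oneMinusZ 0)
  absorb : ∀ k → ℕ→ℚ k * (coef (powP oneMinusZ (k ℕ.∸ 1)) j - shift (coef (powP oneMinusZ (k ℕ.∸ 1))) j)
                 ≡ ℕ→ℚ k * coef (powP oneMinusZ k) j
  absorb zero    = trans (*-zeroˡ (B₀ j - shift B₀ j)) (sym (*-zeroˡ (B₀ j)))
  absorb (suc k) = cong (ℕ→ℚ (suc k) *_) (sym (coef-[1-z]* (powP oneMinusZ k) j))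

deriv-betaPoly : ∀ k m i → deriv (coef (betaPoly k (suc m))) i
  ≡ ℕ→ℚ (suc m) * coef (betaPoly k m) i - ℕ→ℚ k * coef (betaPoly (k ℕ.∸ 1) (suc m)) i
deriv-betaPoly k m i = begin
  deriv (coef (betaPoly k (suc m))) i
    ≡⟨ deriv-cong (coef-betaPoly k (suc m)) i ⟩
  deriv (shiftBy (suc m) B) i
    ≡⟨ deriv-shiftBy m B i ⟩
  ℕ→ℚ (suc m) * shiftBy m B i + shiftBy (suc m) (deriv B) i
    ≡⟨ cong (ℕ→ℚ (suc m) * shiftBy m B i +_)
         (trans (shiftBy-cong (suc m) (deriv-[1-z]^ k) i) (shiftBy-scale (suc m) (- ℕ→ℚ k) B′ i)) ⟩
  ℕ→ℚ (suc m) * shiftBy m B i + - ℕ→ℚ k * shiftBy (suc m) B′ i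
    ≡⟨ cong₂ (λ u v → ℕ→ℚ (suc m) * u + - ℕ→ℚ k * v)
         (sym (coef-betaPoly k m i)) (sym (coef-betaPoly (k ℕ.∸ 1) (suc m) i)) ⟩
  ℕ→ℚ (suc m) * coef (betaPoly k m) i + - ℕ→ℚ k * coef (betaPoly (k ℕ.∸ 1) (suc m)) i
    ≡⟨ solve 4 (λ a x c y → a :* x :+ :- c :* y := a :* x :- c :* y) refl
         (ℕ→ℚ (suc m)) (coef (betaPoly k m) i) (ℕ→ℚ k) (coef (betaPoly (k ℕ.∸ 1) (suc m)) i) ⟩
  ℕ→ℚ (suc m) * coef (betaPoly k m) i - ℕ→ℚ k * coef (betaPoly (k ℕ.∸ 1) (suc m)) i ∎
  where
  B  = coef (powP oneMinusZ k)
  B′ = coef (powP oneMinusZ (k ℕ.∸ 1))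

evalP-cong-[] : ∀ p → coef p ≗ coef [] → ∀ y → evalP p y ≡ 0ℚ
evalP-cong-[] []      p≗0 y = refl
evalP-cong-[] (a ∷ p) p≗0 y = begin
  a + y * evalP p y  ≡⟨ cong₂ (λ u v → u + y * v) (p≗0 0) (evalP-cong-[] p (λ i → p≗0 (suc i)) y) ⟩
  0ℚ + y * 0ℚ        ≡⟨ solve 1 (λ y → con 0ℚ :+ y :* con 0ℚ := con 0ℚ) refl y ⟩
  0ℚ                 ∎

evalP-cong : ∀ p q → coef p ≗ coef q → ∀ y → evalP p y ≡ evalP q y
evalP-cong []      q       p≗q y = sym (evalP-cong-[] q (λ i → sym (p≗q i)) y)
evalP-cong (a ∷ p) []      p≗q y = evalP-cong-[] (a ∷ p) p≗q y
evalP-cong (a ∷ p) (b ∷ q) p≗q y = cong₂ (λ u v → u + y * v) (p≗q 0) (evalP-cong p q (λ i → p≗q (suc i)) y)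

evalP-addP : ∀ p q y → evalP (addP p q) y ≡ evalP p y + evalP q y
evalP-addP []      q       y = sym (+-identityˡ _)
evalP-addP (a ∷ p) []      y = sym (+-identityʳ _)
evalP-addP (a ∷ p) (b ∷ q) y = begin
  (a + b) + y * evalP (addP p q) y
    ≡⟨ cong (λ t → (a + b) + y * t) (evalP-addP p q y) ⟩
  (a + b) + y * (evalP p y + evalP q y)
    ≡⟨ solve 5 (λ a b y u v → (a :+ b) :+ y :* (u :+ v) := (a :+ y :* u) :+ (b :+ y :* v))
             refl a b y (evalP p y) (evalP q y) ⟩
  (a + y * evalP p y) + (b + y * evalP q y) ∎

evalP-scaleP : ∀ c p y → evalP (scaleP c p) y ≡ c * evalP p y
evalP-scaleP c []      y = sym (*-zeroʳ c)
evalP-scaleP c (a ∷ p) y = begin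
  c * a + y * evalP (scaleP c p) y
    ≡⟨ cong (λ t → c * a + y * t) (evalP-scaleP c p y) ⟩
  c * a + y * (c * evalP p y)
    ≡⟨ solve 4 (λ c a y u → c :* a :+ y :* (c :* u) := c :* (a :+ y :* u)) refl c a y (evalP p y) ⟩
  c * (a + y * evalP p y) ∎

evalP-mulP : ∀ p q y → evalP (mulP p q) y ≡ evalP p y * evalP q y
evalP-mulP []      q y = sym (*-zeroˡ (evalP q y))
evalP-mulP (a ∷ p) q y = begin
  evalP (addP (scaleP a q) (0ℚ ∷ mulP p q)) y
    ≡⟨ evalP-addP (scaleP a q) (0ℚ ∷ mulP p q) y ⟩
  evalP (scaleP a q) y + (0ℚ + y * evalP (mulP p q) y)
    ≡⟨ cong₂ (λ u v → u + (0ℚ + y * v)) (evalP-scaleP a q y) (evalP-mulP p q y) ⟩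
  a * evalP q y + (0ℚ + y * (evalP p y * evalP q y))
    ≡⟨ solve 4 (λ a y u v → a :* v :+ (con 0ℚ :+ y :* (u :* v)) := (a :+ y :* u) :* v)
             refl a y (evalP p y) (evalP q y) ⟩
  (a + y * evalP p y) * evalP q y ∎

evalP-powP : ∀ p k y → evalP (powP p k) y ≡ evalP p y ^ k
evalP-powP p zero    y = solve 1 (λ y → con 1ℚ :+ y :* con 0ℚ := con 1ℚ) refl y
evalP-powP p (suc k) y = trans (evalP-mulP p (powP p k) y) (cong (evalP p y *_) (evalP-powP p k y))

evalP-Z : ∀ y → evalP Z y ≡ y
evalP-Z y = solve 1 (λ y → con 0ℚ :+ y :* (con 1ℚ :+ y :* con 0ℚ) := y) refl y

evalP-oneMinusZ : ∀ y → evalP oneMinusZ y ≡ 1ℚ - y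
evalP-oneMinusZ y = solve 1 (λ y → con 1ℚ :+ y :* (:- con 1ℚ :+ y :* con 0ℚ) := con 1ℚ :- y) refl y

evalP-betaPoly : ∀ k m y → evalP (betaPoly k m) y ≡ (1ℚ - y) ^ k * y ^ m
evalP-betaPoly k m y = trans (evalP-mulP (powP oneMinusZ k) (powP Z m) y)
  (cong₂ _*_ (trans (evalP-powP oneMinusZ k y) (cong (_^ k) (evalP-oneMinusZ y)))
             (trans (evalP-powP Z m y) (cong (_^ m) (evalP-Z y))))

coef-antiderivFrom : ∀ j p i → coef (antiderivFrom j p) i ≡ coef p i // ℕ→ℚ (suc (i ℕ.+ j))
coef-antiderivFrom j []      i       =
  sym (p≡r*q⇒p//q≡r (ℕ→ℚ[1+n]≢0 (i ℕ.+ j)) (sym (*-zeroˡ (ℕ→ℚ (suc (i ℕ.+ j))))))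
coef-antiderivFrom j (a ∷ p) zero    = refl
coef-antiderivFrom j (a ∷ p) (suc i) = trans (coef-antiderivFrom (suc j) p i)
  (cong (λ t → coef p i // ℕ→ℚ (suc t)) (ℕ.+-suc i j))

coef-antideriv : ∀ p i → coef (antideriv p) (suc i) ≡ coef p i // ℕ→ℚ (suc i)
coef-antideriv p i = trans (coef-antiderivFrom 0 p i)
  (cong (λ t → coef p i // ℕ→ℚ (suc t)) (ℕ.+-identityʳ i))

antideriv-addP : ∀ p q → coef (antideriv (addP p q)) ≗ coef (addP (antideriv p) (antideriv q))
antideriv-addP p q zero    = refl
antideriv-addP p q (suc i) = begin
  coef (antideriv (addP p q)) (suc i)
    ≡⟨ coef-antideriv (addP p q) i ⟩
  coef (addP p q) i // ℕ→ℚ (suc i)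
    ≡⟨ cong (_// ℕ→ℚ (suc i)) (coef-addP p q i) ⟩
  (coef p i + coef q i) // ℕ→ℚ (suc i)
    ≡⟨ //-distribʳ-+ (ℕ→ℚ[1+n]≢0 i) (coef p i) (coef q i) ⟩
  coef p i // ℕ→ℚ (suc i) + coef q i // ℕ→ℚ (suc i)
    ≡⟨ sym (cong₂ _+_ (coef-antideriv p i) (coef-antideriv q i)) ⟩
  coef (antideriv p) (suc i) + coef (antideriv q) (suc i)
    ≡⟨ sym (coef-addP (antideriv p) (antideriv q) (suc i)) ⟩
  coef (addP (antideriv p) (antideriv q)) (suc i) ∎

antideriv-scaleP : ∀ c p → coef (antideriv (scaleP c p)) ≗ coef (scaleP c (antideriv p))
antideriv-scaleP c p zero    = sym (*-zeroʳ c)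
antideriv-scaleP c p (suc i) = begin
  coef (antideriv (scaleP c p)) (suc i)   ≡⟨ coef-antideriv (scaleP c p) i ⟩
  coef (scaleP c p) i // ℕ→ℚ (suc i)      ≡⟨ cong (_// ℕ→ℚ (suc i)) (coef-scaleP c p i) ⟩
  (c * coef p i) // ℕ→ℚ (suc i)           ≡⟨ *-//-assoc (ℕ→ℚ[1+n]≢0 i) c (coef p i) ⟩
  c * (coef p i // ℕ→ℚ (suc i))           ≡⟨ cong (c *_) (sym (coef-antideriv p i)) ⟩
  c * coef (antideriv p) (suc i)          ≡⟨ sym (coef-scaleP c (antideriv p) (suc i)) ⟩
  coef (scaleP c (antideriv p)) (suc i)   ∎

∫-addP : ∀ p q lo hi → ∫ (addP p q) lo hi ≡ ∫ p lo hi + ∫ q lo hi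
∫-addP p q lo hi = begin
  A (addP p q) hi - A (addP p q) lo
    ≡⟨ cong₂ _-_ (A-addP hi) (A-addP lo) ⟩
  (A p hi + A q hi) - (A p lo + A q lo)
    ≡⟨ solve 4 (λ a b c d → (a :+ b) :- (c :+ d) := (a :- c) :+ (b :- d))
             refl (A p hi) (A q hi) (A p lo) (A q lo) ⟩
  (A p hi - A p lo) + (A q hi - A q lo) ∎
  where
  A : Poly → ℚ → ℚ
  A r = evalP (antideriv r)
  A-addP : ∀ y → A (addP p q) y ≡ A p y + A q y
  A-addP y = trans (evalP-cong (antideriv (addP p q)) (addP (antideriv p) (antideriv q)) (antideriv-addP p q) y)
                   (evalP-addP (antideriv p) (antideriv q) y)

∫-scaleP : ∀ c p lo hi → ∫ (scaleP c p) lo hi ≡ c * ∫ p lo hi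
∫-scaleP c p lo hi = begin
  A (scaleP c p) hi - A (scaleP c p) lo
    ≡⟨ cong₂ _-_ (A-scaleP hi) (A-scaleP lo) ⟩
  c * A p hi - c * A p lo
    ≡⟨ solve 3 (λ c a b → c :* a :- c :* b := c :* (a :- b)) refl c (A p hi) (A p lo) ⟩
  c * (A p hi - A p lo) ∎
  where
  A : Poly → ℚ → ℚ
  A r = evalP (antideriv r)
  A-scaleP : ∀ y → A (scaleP c p) y ≡ c * A p y
  A-scaleP y = trans (evalP-cong (antideriv (scaleP c p)) (scaleP c (antideriv p)) (antideriv-scaleP c p) y)
                     (evalP-scaleP c (antideriv p) y)

∫-fundamental : ∀ p f → coef p ≗ deriv (coef f) → ∀ lo hi → ∫ p lo hi ≡ evalP f hi - evalP f lo
∫-fundamental p f p≗f′ lo hi = begin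
  evalP (antideriv p) hi - evalP (antideriv p) lo
    ≡⟨ cong₂ _-_ (antideriv≡f-f₀ hi) (antideriv≡f-f₀ lo) ⟩
  (evalP f hi - coef f 0) - (evalP f lo - coef f 0)
    ≡⟨ solve 3 (λ a b c → (a :- c) :- (b :- c) := a :- b) refl (evalP f hi) (evalP f lo) (coef f 0) ⟩
  evalP f hi - evalP f lo ∎
  where
  f-f₀ : Poly
  f-f₀ = addP f (- coef f 0 ∷ [])
  coefs : coef (antideriv p) ≗ coef f-f₀
  coefs zero    = sym (trans (coef-addP f (- coef f 0 ∷ []) 0) (+-inverseʳ (coef f 0)))
  coefs (suc i) = begin
    coef (antideriv p) (suc i)
      ≡⟨ coef-antideriv p i ⟩
    coef p i // ℕ→ℚ (suc i)
      ≡⟨ p≡r*q⇒p//q≡r (ℕ→ℚ[1+n]≢0 i) (trans (p≗f′ i) (*-comm (ℕ→ℚ (suc i)) (coef f (suc i)))) ⟩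
    coef f (suc i)
      ≡⟨ sym (+-identityʳ _) ⟩
    coef f (suc i) + 0ℚ
      ≡⟨ sym (coef-addP f (- coef f 0 ∷ []) (suc i)) ⟩
    coef f-f₀ (suc i) ∎
  antideriv≡f-f₀ : ∀ y → evalP (antideriv p) y ≡ evalP f y - coef f 0
  antideriv≡f-f₀ y = begin
    evalP (antideriv p) y
      ≡⟨ evalP-cong (antideriv p) f-f₀ coefs y ⟩
    evalP f-f₀ y
      ≡⟨ evalP-addP f (- coef f 0 ∷ []) y ⟩
    evalP f y + (- coef f 0 + y * 0ℚ)
      ≡⟨ solve 3 (λ a c y → a :+ (:- c :+ y :* con 0ℚ) := a :- c) refl (evalP f y) (coef f 0) y ⟩
    evalP f y - coef f 0 ∎

∫-betaPoly-by-parts : ∀ k m lo hi →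
  ℕ→ℚ (suc m) * ∫ (betaPoly k m) lo hi - ℕ→ℚ k * ∫ (betaPoly (k ℕ.∸ 1) (suc m)) lo hi
    ≡ (1ℚ - hi) ^ k * hi ^ suc m - (1ℚ - lo) ^ k * lo ^ suc m
∫-betaPoly-by-parts k m lo hi = begin
  a * ∫ P lo hi - c * ∫ Q lo hi
    ≡⟨ solve 4 (λ a x c y → a :* x :- c :* y := a :* x :+ (:- c) :* y) refl a (∫ P lo hi) c (∫ Q lo hi) ⟩
  a * ∫ P lo hi + (- c) * ∫ Q lo hi
    ≡⟨ sym (cong₂ _+_ (∫-scaleP a P lo hi) (∫-scaleP (- c) Q lo hi)) ⟩
  ∫ (scaleP a P) lo hi + ∫ (scaleP (- c) Q) lo hi
    ≡⟨ sym (∫-addP (scaleP a P) (scaleP (- c) Q) lo hi) ⟩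
  ∫ L lo hi
    ≡⟨ ∫-fundamental L (betaPoly k (suc m)) coefs lo hi ⟩
  evalP (betaPoly k (suc m)) hi - evalP (betaPoly k (suc m)) lo
    ≡⟨ cong₂ _-_ (evalP-betaPoly k (suc m) hi) (evalP-betaPoly k (suc m) lo) ⟩
  (1ℚ - hi) ^ k * hi ^ suc m - (1ℚ - lo) ^ k * lo ^ suc m ∎
  where
  a = ℕ→ℚ (suc m)
  c = ℕ→ℚ k
  P = betaPoly k m
  Q = betaPoly (k ℕ.∸ 1) (suc m)
  L = addP (scaleP a P) (scaleP (- c) Q)
  coefs : coef L ≗ deriv (coef (betaPoly k (suc m)))
  coefs i = begin
    coef L i                                   ≡⟨ coef-addP (scaleP a P) (scaleP (- c) Q) i ⟩
    coef (scaleP a P) i + coef (scaleP (- c) Q) i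
      ≡⟨ cong₂ _+_ (coef-scaleP a P i) (coef-scaleP (- c) Q i) ⟩
    a * coef P i + (- c) * coef Q i
      ≡⟨ solve 4 (λ a x c y → a :* x :+ (:- c) :* y := a :* x :- c :* y) refl a (coef P i) c (coef Q i) ⟩
    a * coef P i - c * coef Q i                ≡⟨ sym (deriv-betaPoly k m i) ⟩
    deriv (coef (betaPoly k (suc m))) i        ∎

∫₀-betaPoly-by-parts : ∀ k m q →
  ℕ→ℚ (suc m) * ∫ (betaPoly k m) 0ℚ (1ℚ - q) - ℕ→ℚ k * ∫ (betaPoly (k ℕ.∸ 1) (suc m)) 0ℚ (1ℚ - q)
    ≡ q ^ k * (1ℚ - q) ^ suc m
∫₀-betaPoly-by-parts k m q = begin
  _ ≡⟨ ∫-betaPoly-by-parts k m 0ℚ (1ℚ - q) ⟩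
  (1ℚ - (1ℚ - q)) ^ k * (1ℚ - q) ^ suc m - (1ℚ - 0ℚ) ^ k * (0ℚ * 0ℚ ^ m)
    ≡⟨ cong (λ t → t ^ k * (1ℚ - q) ^ suc m - (1ℚ - 0ℚ) ^ k * (0ℚ * 0ℚ ^ m))
            (solve 1 (λ q → con 1ℚ :- (con 1ℚ :- q) := q) refl q) ⟩
  q ^ k * (1ℚ - q) ^ suc m - (1ℚ - 0ℚ) ^ k * (0ℚ * 0ℚ ^ m)
    ≡⟨ solve 3 (λ x u z → x :- u :* (con 0ℚ :* z) := x) refl (q ^ k * (1ℚ - q) ^ suc m) ((1ℚ - 0ℚ) ^ k) (0ℚ ^ m) ⟩
  q ^ k * (1ℚ - q) ^ suc m ∎

[n∸k]*nCk≡[1+k]*nC[1+k] : ∀ n k → (n ℕ.∸ k) ℕ.* (n C k) ≡ suc k ℕ.* (n C suc k)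
[n∸k]*nCk≡[1+k]*nC[1+k] zero    zero    = refl
[n∸k]*nCk≡[1+k]*nC[1+k] zero    (suc k) = sym (ℕ.*-zeroʳ (suc (suc k)))
[n∸k]*nCk≡[1+k]*nC[1+k] (suc n) zero    =
  trans (ℕ.*-identityʳ (suc n)) (sym (trans (ℕ.+-identityʳ (suc n C 1)) (nC1≡n (suc n))))
[n∸k]*nCk≡[1+k]*nC[1+k] (suc n) (suc k) = begin
  (n ℕ.∸ k) ℕ.* (suc n C suc k)
    ≡⟨ cong ((n ℕ.∸ k) ℕ.*_) (sym (nCk+nC[k+1]≡[n+1]C[k+1] n k)) ⟩
  (n ℕ.∸ k) ℕ.* (n C k ℕ.+ X)
    ≡⟨ ℕ.*-distribˡ-+ (n ℕ.∸ k) (n C k) X ⟩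
  (n ℕ.∸ k) ℕ.* (n C k) ℕ.+ (n ℕ.∸ k) ℕ.* X
    ≡⟨ cong₂ ℕ._+_ ([n∸k]*nCk≡[1+k]*nC[1+k] n k) [n∸k]*X≡X+[n∸1+k]*X ⟩
  suc k ℕ.* X ℕ.+ (X ℕ.+ (n ℕ.∸ suc k) ℕ.* X)
    ≡⟨ cong (λ t → suc k ℕ.* X ℕ.+ (X ℕ.+ t)) ([n∸k]*nCk≡[1+k]*nC[1+k] n (suc k)) ⟩
  suc k ℕ.* X ℕ.+ (X ℕ.+ suc (suc k) ℕ.* Y)
    ≡⟨ sym (ℕ.+-assoc (suc k ℕ.* X) X _) ⟩
  suc k ℕ.* X ℕ.+ X ℕ.+ suc (suc k) ℕ.* Y
    ≡⟨ cong (ℕ._+ suc (suc k) ℕ.* Y) (ℕ.+-comm (suc k ℕ.* X) X) ⟩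
  suc (suc k) ℕ.* X ℕ.+ suc (suc k) ℕ.* Y
    ≡⟨ sym (ℕ.*-distribˡ-+ (suc (suc k)) X Y) ⟩
  suc (suc k) ℕ.* (X ℕ.+ Y)
    ≡⟨ cong (suc (suc k) ℕ.*_) (nCk+nC[k+1]≡[n+1]C[k+1] n (suc k)) ⟩
  suc (suc k) ℕ.* (suc n C suc (suc k)) ∎
  where
  X = n C suc k
  Y = n C suc (suc k)
  [n∸k]*X≡X+[n∸1+k]*X : (n ℕ.∸ k) ℕ.* X ≡ X ℕ.+ (n ℕ.∸ suc k) ℕ.* X
  [n∸k]*X≡X+[n∸1+k]*X with k ℕ.<? n
  ... | yes k<n = cong (ℕ._* X) (ℕ.+-∸-assoc 1 k<n)
  ... | no  k≮n rewrite k>n⇒nCk≡0 (ℕ.≰⇒> k≮n) =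
    trans (ℕ.*-zeroʳ (n ℕ.∸ k)) (sym (ℕ.*-zeroʳ (n ℕ.∸ suc k)))

binomial-absorption : ∀ n k → ℕ→ℚ (n ℕ.∸ k) * ℕ→ℚ (n C k) ≡ ℕ→ℚ (suc k) * ℕ→ℚ (n C suc k)
binomial-absorption n k = begin
  ℕ→ℚ (n ℕ.∸ k) * ℕ→ℚ (n C k)        ≡⟨ sym (ℕ→ℚ-homo-* (n ℕ.∸ k) (n C k)) ⟩
  ℕ→ℚ ((n ℕ.∸ k) ℕ.* (n C k))         ≡⟨ cong ℕ→ℚ ([n∸k]*nCk≡[1+k]*nC[1+k] n k) ⟩
  ℕ→ℚ (suc k ℕ.* (n C suc k))         ≡⟨ ℕ→ℚ-homo-* (suc k) (n C suc k) ⟩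
  ℕ→ℚ (suc k) * ℕ→ℚ (n C suc k)       ∎

binomTerm : ℕ → ℚ → ℕ → ℚ
binomTerm n q j = ℕ→ℚ (n C j) * (q ^ j) * ((1ℚ - q) ^ (n ℕ.∸ j))

-- P(Bin(n, q) < c); thus pbn b n is binomCDF n b (b/n) by definition.
binomCDF : ℕ → ℕ → ℚ → ℚ
binomCDF n c q = Σ< c (binomTerm n q)

binomCDF-at-0 : ∀ n c → binomCDF n (suc c) 0ℚ ≡ 1ℚ
binomCDF-at-0 n zero    = cong (λ t → 0ℚ + 1ℚ * 1ℚ * t) (^-zeroˡ n)
binomCDF-at-0 n (suc c) = begin
  binomCDF n (suc c) 0ℚ + ℕ→ℚ (n C suc c) * (0ℚ * 0ℚ ^ c) * (1ℚ - 0ℚ) ^ (n ℕ.∸ suc c)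
    ≡⟨ cong (_+ ℕ→ℚ (n C suc c) * (0ℚ * 0ℚ ^ c) * (1ℚ - 0ℚ) ^ (n ℕ.∸ suc c)) (binomCDF-at-0 n c) ⟩
  1ℚ + ℕ→ℚ (n C suc c) * (0ℚ * 0ℚ ^ c) * (1ℚ - 0ℚ) ^ (n ℕ.∸ suc c)
    ≡⟨ solve 3 (λ a z u → con 1ℚ :+ a :* (con 0ℚ :* z) :* u := con 1ℚ) refl
         (ℕ→ℚ (n C suc c)) (0ℚ ^ c) ((1ℚ - 0ℚ) ^ (n ℕ.∸ suc c)) ⟩
  1ℚ ∎

binomCDF-as-∫ : ∀ {n} k m q → n ≡ suc k ℕ.+ m →
  binomCDF n (suc k) q ≡ ℕ→ℚ (suc k) * ℕ→ℚ (n C suc k) * ∫ (betaPoly k m) 0ℚ (1ℚ - q)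
binomCDF-as-∫ zero m q refl = begin
  0ℚ + 1ℚ * 1ℚ * (1ℚ - q) ^ suc m
    ≡⟨ solve 1 (λ y → con 0ℚ :+ con 1ℚ :* con 1ℚ :* y := con 1ℚ :* y) refl ((1ℚ - q) ^ suc m) ⟩
  q ^ 0 * (1ℚ - q) ^ suc m
    ≡⟨ sym (∫₀-betaPoly-by-parts 0 m q) ⟩
  ℕ→ℚ (suc m) * I - 0ℚ * I′
    ≡⟨ solve 3 (λ a x y → a :* x :- con 0ℚ :* y := con 1ℚ :* a :* x) refl (ℕ→ℚ (suc m)) I I′ ⟩
  1ℚ * ℕ→ℚ (suc m) * I
    ≡⟨ cong (λ t → 1ℚ * ℕ→ℚ t * I) (sym (nC1≡n (suc m))) ⟩
  1ℚ * ℕ→ℚ (suc m C 1) * I ∎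
  where
  I  = ∫ (betaPoly 0 m) 0ℚ (1ℚ - q)
  I′ = ∫ (betaPoly 0 (suc m)) 0ℚ (1ℚ - q)
binomCDF-as-∫ {n} (suc k) m q n≡2+k+m = begin
  binomCDF n (suc k) q + C₁ * q ^ suc k * (1ℚ - q) ^ (n ℕ.∸ suc k)
    ≡⟨ cong₂ (λ u e → u + C₁ * q ^ suc k * (1ℚ - q) ^ e) (binomCDF-as-∫ k (suc m) q n≡1+k+1+m) n∸[1+k]≡1+m ⟩
  ℕ→ℚ (suc k) * C₁ * I₁ + C₁ * q ^ suc k * (1ℚ - q) ^ suc m
    ≡⟨ solve 5 (λ a c i x y → a :* c :* i :+ c :* x :* y := a :* c :* i :+ c :* (x :* y)) refl
         (ℕ→ℚ (suc k)) C₁ I₁ (q ^ suc k) ((1ℚ - q) ^ suc m) ⟩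
  ℕ→ℚ (suc k) * C₁ * I₁ + C₁ * (q ^ suc k * (1ℚ - q) ^ suc m)
    ≡⟨ cong (λ t → ℕ→ℚ (suc k) * C₁ * I₁ + C₁ * t) (sym (∫₀-betaPoly-by-parts (suc k) m q)) ⟩
  ℕ→ℚ (suc k) * C₁ * I₁ + C₁ * (ℕ→ℚ (suc m) * I₂ - ℕ→ℚ (suc k) * I₁)
    ≡⟨ solve 5 (λ a c i b j → a :* c :* i :+ c :* (b :* j :- a :* i) := b :* c :* j) refl
         (ℕ→ℚ (suc k)) C₁ I₁ (ℕ→ℚ (suc m)) I₂ ⟩
  ℕ→ℚ (suc m) * C₁ * I₂
    ≡⟨ cong (λ t → ℕ→ℚ t * C₁ * I₂) (sym n∸[1+k]≡1+m) ⟩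
  ℕ→ℚ (n ℕ.∸ suc k) * C₁ * I₂
    ≡⟨ cong (_* I₂) (binomial-absorption n (suc k)) ⟩
  ℕ→ℚ (suc (suc k)) * ℕ→ℚ (n C suc (suc k)) * I₂ ∎
  where
  C₁ = ℕ→ℚ (n C suc k)
  I₁ = ∫ (betaPoly k (suc m)) 0ℚ (1ℚ - q)
  I₂ = ∫ (betaPoly (suc k) m) 0ℚ (1ℚ - q)
  n≡1+k+1+m : n ≡ suc k ℕ.+ suc m
  n≡1+k+1+m = trans n≡2+k+m (cong suc (sym (ℕ.+-suc k m)))
  n∸[1+k]≡1+m : n ℕ.∸ suc k ≡ suc m
  n∸[1+k]≡1+m = trans (cong (ℕ._∸ suc k) n≡1+k+1+m) (ℕ.m+n∸m≡n (suc k) (suc m))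

½ : ℚ
½ = 1ℚ // ℕ→ℚ 2

½≢0 : ½ ≢ 0ℚ
½≢0 ()

ℕ→ℚ[n]^n≢0 : ∀ a → ℕ→ℚ a ^ a ≢ 0ℚ
ℕ→ℚ[n]^n≢0 zero    = 1≢0
ℕ→ℚ[n]^n≢0 (suc a) = p^n≢0 (suc a) (ℕ→ℚ[1+n]≢0 a)

1-c//n≡[n∸c]//n : ∀ {n c} → c ≤ n → ℕ→ℚ n ≢ 0ℚ → 1ℚ - ℕ→ℚ c // ℕ→ℚ n ≡ ℕ→ℚ (n ℕ.∸ c) // ℕ→ℚ n
1-c//n≡[n∸c]//n {n} {c} c≤n n≢0 = sym (p≡r*q⇒p//q≡r n≢0 (begin
  ℕ→ℚ (n ℕ.∸ c)
    ≡⟨ ℕ→ℚ-homo-∸ c≤n ⟩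
  ℕ→ℚ n - ℕ→ℚ c
    ≡⟨ cong (λ t → ℕ→ℚ n - t) (sym (p//q*q≡p n≢0 (ℕ→ℚ c))) ⟩
  ℕ→ℚ n - (ℕ→ℚ c // ℕ→ℚ n) * ℕ→ℚ n
    ≡⟨ solve 2 (λ n u → n :- u :* n := (con 1ℚ :- u) :* n) refl (ℕ→ℚ n) (ℕ→ℚ c // ℕ→ℚ n) ⟩
  (1ℚ - ℕ→ℚ c // ℕ→ℚ n) * ℕ→ℚ n ∎))

binomial-weight : ∀ {n c} → c ≤ n → ℕ→ℚ n ≢ 0ℚ →
  (ℕ→ℚ c // ℕ→ℚ n) ^ c * (1ℚ - ℕ→ℚ c // ℕ→ℚ n) ^ (n ℕ.∸ c) * ℕ→ℚ n ^ n ≡ ℕ→ℚ c ^ c * ℕ→ℚ (n ℕ.∸ c) ^ (n ℕ.∸ c)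
binomial-weight {n} {c} c≤n n≢0 = begin
  u ^ c * (1ℚ - u) ^ d * ℕ→ℚ n ^ n
    ≡⟨ cong₂ (λ v e → u ^ c * v ^ d * ℕ→ℚ n ^ e) (1-c//n≡[n∸c]//n c≤n n≢0) (sym (ℕ.m+[n∸m]≡n c≤n)) ⟩
  u ^ c * v ^ d * ℕ→ℚ n ^ (c ℕ.+ d)
    ≡⟨ cong (u ^ c * v ^ d *_) (^-distribˡ-+-* (ℕ→ℚ n) c d) ⟩
  u ^ c * v ^ d * (ℕ→ℚ n ^ c * ℕ→ℚ n ^ d)
    ≡⟨ solve 4 (λ a b x y → a :* b :* (x :* y) := (a :* x) :* (b :* y))
             refl (u ^ c) (v ^ d) (ℕ→ℚ n ^ c) (ℕ→ℚ n ^ d) ⟩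
  (u ^ c * ℕ→ℚ n ^ c) * (v ^ d * ℕ→ℚ n ^ d)
    ≡⟨ cong₂ _*_ (p*c≡u⇒p^n*c^n≡u^n c (p//q*q≡p n≢0 (ℕ→ℚ c))) (p*c≡u⇒p^n*c^n≡u^n d (p//q*q≡p n≢0 (ℕ→ℚ d))) ⟩
  ℕ→ℚ c ^ c * ℕ→ℚ d ^ d ∎
  where
  d = n ℕ.∸ c
  u = ℕ→ℚ c // ℕ→ℚ n
  v = ℕ→ℚ d // ℕ→ℚ n

module _ (n k : ℕ) (b≤n : suc k ≤ n) where
  private
    b = suc k
    m = n ℕ.∸ b
    nCb = ℕ→ℚ (n C b)
    q = ℕ→ℚ b // ℕ→ℚ n
    y = 1ℚ - q
    q′ = ℕ→ℚ (suc b) // ℕ→ℚ n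
    y′ = 1ℚ - q′
    g = gPoly b n
    -- ∫ g lo hi unfolds to A hi - A lo, so the ring solver can relate integrals with different bounds.
    A : ℚ → ℚ
    A = evalP (antideriv g)
    I : ℚ → ℚ
    I t = ∫ g 0ℚ t

    n≡b+m : n ≡ b ℕ.+ m
    n≡b+m = sym (ℕ.m+[n∸m]≡n b≤n)

    n≢0 : ℕ→ℚ n ≢ 0ℚ
    n≢0 = subst (λ t → ℕ→ℚ t ≢ 0ℚ) (sym n≡b+m) (ℕ→ℚ[1+n]≢0 (k ℕ.+ m))

    binomCDF≡∫ : ∀ t → binomCDF n b t ≡ ℕ→ℚ b * nCb * I (1ℚ - t)
    binomCDF≡∫ t = binomCDF-as-∫ k m t n≡b+m

    normalisation : ℕ→ℚ b * nCb * I 1ℚ ≡ 1ℚ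
    normalisation = trans (sym (binomCDF≡∫ 0ℚ)) (binomCDF-at-0 n k)

    nCb≢0 : nCb ≢ 0ℚ
    nCb≢0 = p*q≢0⇒q≢0 {ℕ→ℚ b}
      (p*q≢0⇒p≢0 {ℕ→ℚ b * nCb} {I 1ℚ} (λ eq → 1≢0 (trans (sym normalisation) eq)))

  pbn-as-∫ : pbn b n ≡ I y // I 1ℚ
  pbn-as-∫ = begin
    pbn b n               ≡⟨ binomCDF≡∫ q ⟩
    ℕ→ℚ b * nCb * I y     ≡⟨ *-comm (ℕ→ℚ b * nCb) (I y) ⟩
    I y * (ℕ→ℚ b * nCb)   ≡⟨ sym (p*q≡1⇒r//q≡r*p normalisation (I y)) ⟩
    I y // I 1ℚ           ∎

  zbn-as-∫ : zbn b n ≡ (½ * ℕ→ℚ b * (∫ g y 1ℚ - ∫ g 0ℚ y)) // (q ^ b * y ^ m)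
  zbn-as-∫ = begin
    (½ - pbn b n) // (nCb * q ^ b * y ^ m)
      ≡⟨ cong₂ _//_ ½-pbn≡nCb*_ (*-assoc nCb (q ^ b) (y ^ m)) ⟩
    (nCb * (½ * ℕ→ℚ b * (∫ g y 1ℚ - ∫ g 0ℚ y))) // (nCb * (q ^ b * y ^ m))
      ≡⟨ c*p//c*q≡p//q nCb≢0 (½ * ℕ→ℚ b * (∫ g y 1ℚ - ∫ g 0ℚ y)) (q ^ b * y ^ m) ⟩
    (½ * ℕ→ℚ b * (∫ g y 1ℚ - ∫ g 0ℚ y)) // (q ^ b * y ^ m) ∎
    where
    ½-pbn≡nCb*_ : ½ - pbn b n ≡ nCb * (½ * ℕ→ℚ b * (∫ g y 1ℚ - ∫ g 0ℚ y))
    ½-pbn≡nCb*_ = begin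
      ½ - pbn b n
        ≡⟨ cong (_- pbn b n) (sym (*-identityʳ ½)) ⟩
      ½ * 1ℚ - pbn b n
        ≡⟨ cong₂ (λ u v → ½ * u - v) (sym normalisation) (binomCDF≡∫ q) ⟩
      ½ * (ℕ→ℚ b * nCb * I 1ℚ) - ℕ→ℚ b * nCb * I y
        ≡⟨ solve 5 (λ nb c a₀ a₁ a → con ½ :* (nb :* c :* (a₁ :- a₀)) :- nb :* c :* (a :- a₀)
                                      := c :* (con ½ :* nb :* ((a₁ :- a) :- (a :- a₀))))
                 refl (ℕ→ℚ b) nCb (A 0ℚ) (A 1ℚ) (A y) ⟩
      nCb * (½ * ℕ→ℚ b * (∫ g y 1ℚ - ∫ g 0ℚ y)) ∎

  pbn-difference : pbn (suc b) n - pbn b n ≡ (q′ ^ b * y′ ^ m - ℕ→ℚ b * ∫ g y′ y) // (ℕ→ℚ b * I 1ℚ)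
  pbn-difference = begin
    pbn (suc b) n - pbn b n
      ≡⟨ cong₂ (λ u v → u + nCb * q′ ^ b * y′ ^ m - v) (binomCDF≡∫ q′) (binomCDF≡∫ q) ⟩
    ℕ→ℚ b * nCb * I y′ + nCb * q′ ^ b * y′ ^ m - ℕ→ℚ b * nCb * I y
      ≡⟨ solve 7 (λ nb c a₀ a′ a x z → nb :* c :* (a′ :- a₀) :+ c :* x :* z :- nb :* c :* (a :- a₀)
                                          := (x :* z :- nb :* (a :- a′)) :* c)
               refl (ℕ→ℚ b) nCb (A 0ℚ) (A y′) (A y) (q′ ^ b) (y′ ^ m) ⟩
    (q′ ^ b * y′ ^ m - ℕ→ℚ b * ∫ g y′ y) * nCb
      ≡⟨ sym (p*q≡1⇒r//q≡r*p nCb*[b*I₁]≡1 (q′ ^ b * y′ ^ m - ℕ→ℚ b * ∫ g y′ y)) ⟩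
    (q′ ^ b * y′ ^ m - ℕ→ℚ b * ∫ g y′ y) // (ℕ→ℚ b * I 1ℚ) ∎
    where
    nCb*[b*I₁]≡1 : nCb * (ℕ→ℚ b * I 1ℚ) ≡ 1ℚ
    nCb*[b*I₁]≡1 = trans (solve 3 (λ c nb i → c :* (nb :* i) := nb :* c :* i) refl nCb (ℕ→ℚ b) (I 1ℚ))
                         normalisation

  module _ (b<n : suc b ≤ n) where
    private
      m′ = n ℕ.∸ b ℕ.∸ 1
      nC[1+b] = ℕ→ℚ (n C suc b)
      D = ℕ→ℚ 2 * ℕ→ℚ m * ℕ→ℚ (suc b) ^ b * ℕ→ℚ m′ ^ m′
      K = ℕ→ℚ n ^ n // D
      R₁ = (1ℚ + 1ℚ // ℕ→ℚ b) ^ b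
      R₂ = (1ℚ - 1ℚ // ℕ→ℚ m) ^ m′
      X = ℕ→ℚ m′ // ℕ→ℚ n
      W = q ^ b * y ^ m
      W′ = q′ ^ suc b * y′ ^ (n ℕ.∸ suc b)
      E = ∫ g y 1ℚ - ∫ g 0ℚ y
      E′ = ∫ g y′ 1ℚ - ∫ g 0ℚ y′

      m≡1+[n∸1+b] : m ≡ suc (n ℕ.∸ suc b)
      m≡1+[n∸1+b] = ℕ.+-∸-assoc 1 b<n

      m′≡n∸1+b : m′ ≡ n ℕ.∸ suc b
      m′≡n∸1+b = cong (ℕ._∸ 1) m≡1+[n∸1+b]

      m≡1+m′ : m ≡ suc m′
      m≡1+m′ = trans m≡1+[n∸1+b] (cong suc (sym m′≡n∸1+b))

      m≢0 : ℕ→ℚ m ≢ 0ℚ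
      m≢0 = subst (λ t → ℕ→ℚ t ≢ 0ℚ) (sym m≡1+m′) (ℕ→ℚ[1+n]≢0 m′)

      D≢0 : D ≢ 0ℚ
      D≢0 = p*q≢0 (p*q≢0 (p*q≢0 (ℕ→ℚ[1+n]≢0 1) m≢0) (p^n≢0 b (ℕ→ℚ[1+n]≢0 b))) (ℕ→ℚ[n]^n≢0 m′)

      K*D≡nⁿ : K * D ≡ ℕ→ℚ n ^ n
      K*D≡nⁿ = p//q*q≡p D≢0 (ℕ→ℚ n ^ n)

      R₁*bᵇ≡[1+b]ᵇ : R₁ * ℕ→ℚ b ^ b ≡ ℕ→ℚ (suc b) ^ b
      R₁*bᵇ≡[1+b]ᵇ = p*c≡u⇒p^n*c^n≡u^n {1ℚ + 1ℚ // ℕ→ℚ b} b (begin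
        (1ℚ + 1ℚ // ℕ→ℚ b) * ℕ→ℚ b
          ≡⟨ solve 2 (λ u x → (con 1ℚ :+ u) :* x := x :+ u :* x) refl (1ℚ // ℕ→ℚ b) (ℕ→ℚ b) ⟩
        ℕ→ℚ b + (1ℚ // ℕ→ℚ b) * ℕ→ℚ b
          ≡⟨ cong (ℕ→ℚ b +_) (p//q*q≡p (ℕ→ℚ[1+n]≢0 k) 1ℚ) ⟩
        ℕ→ℚ b + 1ℚ
          ≡⟨ sym (ℕ→ℚ-homo-+ b 1) ⟩
        ℕ→ℚ (b ℕ.+ 1)
          ≡⟨ cong ℕ→ℚ (ℕ.+-comm b 1) ⟩
        ℕ→ℚ (suc b) ∎)

      R₂*mᵐ′≡m′ᵐ′ : R₂ * ℕ→ℚ m ^ m′ ≡ ℕ→ℚ m′ ^ m′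
      R₂*mᵐ′≡m′ᵐ′ = p*c≡u⇒p^n*c^n≡u^n {1ℚ - 1ℚ // ℕ→ℚ m} m′ (begin
        (1ℚ - 1ℚ // ℕ→ℚ m) * ℕ→ℚ m
          ≡⟨ cong (_* ℕ→ℚ m) (1-c//n≡[n∸c]//n (subst (1 ≤_) (sym m≡1+m′) (s≤s z≤n)) m≢0) ⟩
        (ℕ→ℚ m′ // ℕ→ℚ m) * ℕ→ℚ m
          ≡⟨ p//q*q≡p m≢0 (ℕ→ℚ m′) ⟩
        ℕ→ℚ m′ ∎)

      -- Multiplied by D bᵇ mᵐ′, both sides become (1+b)ᵇ m′ᵐ′ bᵇ mᵐ.
      K*R₁*R₂*W≡½ : K * R₁ * R₂ * W ≡ ½
      K*R₁*R₂*W≡½ = *-cancelʳ F≢0 (begin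
        K * R₁ * R₂ * W * F
          ≡⟨ solve 7 (λ κ r s w δ x z → κ :* r :* s :* w :* (δ :* x :* z) := κ :* δ :* (r :* x) :* (s :* z) :* w)
                   refl K R₁ R₂ W D (ℕ→ℚ b ^ b) (ℕ→ℚ m ^ m′) ⟩
        K * D * (R₁ * ℕ→ℚ b ^ b) * (R₂ * ℕ→ℚ m ^ m′) * W
          ≡⟨ cong₂ (λ u v → u * v * (R₂ * ℕ→ℚ m ^ m′) * W) K*D≡nⁿ R₁*bᵇ≡[1+b]ᵇ ⟩
        ℕ→ℚ n ^ n * ℕ→ℚ (suc b) ^ b * (R₂ * ℕ→ℚ m ^ m′) * W
          ≡⟨ cong (λ t → ℕ→ℚ n ^ n * ℕ→ℚ (suc b) ^ b * t * W) R₂*mᵐ′≡m′ᵐ′ ⟩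
        ℕ→ℚ n ^ n * ℕ→ℚ (suc b) ^ b * ℕ→ℚ m′ ^ m′ * W
          ≡⟨ solve 4 (λ ν β μ w → ν :* β :* μ :* w := β :* μ :* (w :* ν))
                   refl (ℕ→ℚ n ^ n) (ℕ→ℚ (suc b) ^ b) (ℕ→ℚ m′ ^ m′) W ⟩
        ℕ→ℚ (suc b) ^ b * ℕ→ℚ m′ ^ m′ * (W * ℕ→ℚ n ^ n)
          ≡⟨ cong (ℕ→ℚ (suc b) ^ b * ℕ→ℚ m′ ^ m′ *_) (binomial-weight b≤n n≢0) ⟩
        ℕ→ℚ (suc b) ^ b * ℕ→ℚ m′ ^ m′ * (ℕ→ℚ b ^ b * ℕ→ℚ m ^ m)
          ≡⟨ cong (λ e → ℕ→ℚ (suc b) ^ b * ℕ→ℚ m′ ^ m′ * (ℕ→ℚ b ^ b * ℕ→ℚ m ^ e)) m≡1+m′ ⟩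
        ℕ→ℚ (suc b) ^ b * ℕ→ℚ m′ ^ m′ * (ℕ→ℚ b ^ b * (ℕ→ℚ m * ℕ→ℚ m ^ m′))
          ≡⟨ solve 5 (λ β μ x μ₀ z → β :* μ :* (x :* (μ₀ :* z)) := con ½ :* (con (ℕ→ℚ 2) :* μ₀ :* β :* μ :* x :* z))
                   refl (ℕ→ℚ (suc b) ^ b) (ℕ→ℚ m′ ^ m′) (ℕ→ℚ b ^ b) (ℕ→ℚ m) (ℕ→ℚ m ^ m′) ⟩
        ½ * F ∎)
        where
        F = D * ℕ→ℚ b ^ b * ℕ→ℚ m ^ m′
        F≢0 : F ≢ 0ℚ
        F≢0 = p*q≢0 (p*q≢0 D≢0 (p^n≢0 b (ℕ→ℚ[1+n]≢0 k))) (p^n≢0 m′ m≢0)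

      K*W′*m≡½*[1+b] : K * W′ * ℕ→ℚ m ≡ ½ * ℕ→ℚ (suc b)
      K*W′*m≡½*[1+b] = *-cancelʳ D≢0 (begin
        K * W′ * ℕ→ℚ m * D
          ≡⟨ solve 4 (λ κ w μ δ → κ :* w :* μ :* δ := κ :* δ :* w :* μ) refl K W′ (ℕ→ℚ m) D ⟩
        K * D * W′ * ℕ→ℚ m
          ≡⟨ cong (λ t → t * W′ * ℕ→ℚ m) K*D≡nⁿ ⟩
        ℕ→ℚ n ^ n * W′ * ℕ→ℚ m
          ≡⟨ cong (_* ℕ→ℚ m) (trans (*-comm (ℕ→ℚ n ^ n) W′) (binomial-weight b<n n≢0)) ⟩
        ℕ→ℚ (suc b) ^ suc b * ℕ→ℚ (n ℕ.∸ suc b) ^ (n ℕ.∸ suc b) * ℕ→ℚ m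
          ≡⟨ cong (λ t → ℕ→ℚ (suc b) ^ suc b * ℕ→ℚ t ^ t * ℕ→ℚ m) (sym m′≡n∸1+b) ⟩
        ℕ→ℚ (suc b) * ℕ→ℚ (suc b) ^ b * ℕ→ℚ m′ ^ m′ * ℕ→ℚ m
          ≡⟨ solve 4 (λ β₀ β μ μ₀ → β₀ :* β :* μ :* μ₀ := con ½ :* β₀ :* (con (ℕ→ℚ 2) :* μ₀ :* β :* μ))
                   refl (ℕ→ℚ (suc b)) (ℕ→ℚ (suc b) ^ b) (ℕ→ℚ m′ ^ m′) (ℕ→ℚ m) ⟩
        ½ * ℕ→ℚ (suc b) * D ∎)

    zbn-at-b : zbn b n ≡ K * (ℕ→ℚ b * R₁ * R₂ * E)
    zbn-at-b = begin
      zbn b n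
        ≡⟨ zbn-as-∫ ⟩
      (½ * ℕ→ℚ b * E) // W
        ≡⟨ p≡r*q⇒p//q≡r W≢0 (begin
             ½ * ℕ→ℚ b * E
               ≡⟨ cong (λ t → t * ℕ→ℚ b * E) (sym K*R₁*R₂*W≡½) ⟩
             K * R₁ * R₂ * W * ℕ→ℚ b * E
               ≡⟨ solve 6 (λ κ r s w β e → κ :* r :* s :* w :* β :* e := κ :* (β :* r :* s :* e) :* w)
                        refl K R₁ R₂ W (ℕ→ℚ b) E ⟩
             K * (ℕ→ℚ b * R₁ * R₂ * E) * W ∎) ⟩
      K * (ℕ→ℚ b * R₁ * R₂ * E) ∎
      where
      W≢0 : W ≢ 0ℚ
      W≢0 = p*q≢0⇒q≢0 {K * R₁ * R₂} (λ eq → ½≢0 (trans (sym K*R₁*R₂*W≡½) eq))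

    zbn-at-1+b : zbn (suc b) n ≡ K * ((0ℚ - ℕ→ℚ 2 * q′ ^ b * X ^ m) + ℕ→ℚ b * E′)
    zbn-at-1+b = begin
      (½ - pbn (suc b) n) // (nC[1+b] * q′ ^ suc b * y′ ^ (n ℕ.∸ suc b))
        ≡⟨ cong (_// (nC[1+b] * q′ ^ suc b * y′ ^ (n ℕ.∸ suc b))) ½-pbn≡nCb*_ ⟩
      (nCb * (½ * G)) // (nC[1+b] * q′ ^ suc b * y′ ^ (n ℕ.∸ suc b))
        ≡⟨ p≡r*q⇒p//q≡r pmf≢0 (*-cancelʳ m≢0 cross-multiplied) ⟩
      K * G
        ≡⟨ cong (λ t → K * ((0ℚ - ℕ→ℚ 2 * q′ ^ b * t ^ m) + ℕ→ℚ b * E′)) y′≡X ⟩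
      K * ((0ℚ - ℕ→ℚ 2 * q′ ^ b * X ^ m) + ℕ→ℚ b * E′) ∎
      where
      G = (0ℚ - ℕ→ℚ 2 * q′ ^ b * y′ ^ m) + ℕ→ℚ b * E′

      ½-pbn≡nCb*_ : ½ - pbn (suc b) n ≡ nCb * (½ * G)
      ½-pbn≡nCb*_ = begin
        ½ - pbn (suc b) n
          ≡⟨ cong (_- pbn (suc b) n) (sym (*-identityʳ ½)) ⟩
        ½ * 1ℚ - pbn (suc b) n
          ≡⟨ cong₂ (λ u v → ½ * u - (v + nCb * q′ ^ b * y′ ^ m)) (sym normalisation) (binomCDF≡∫ q′) ⟩
        ½ * (ℕ→ℚ b * nCb * I 1ℚ) - (ℕ→ℚ b * nCb * I y′ + nCb * q′ ^ b * y′ ^ m)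
          ≡⟨ solve 7 (λ β c a₀ a₁ a′ x z →
                con ½ :* (β :* c :* (a₁ :- a₀)) :- (β :* c :* (a′ :- a₀) :+ c :* x :* z)
                  := c :* (con ½ :* ((con 0ℚ :- con (ℕ→ℚ 2) :* x :* z) :+ β :* ((a₁ :- a′) :- (a′ :- a₀)))))
                 refl (ℕ→ℚ b) nCb (A 0ℚ) (A 1ℚ) (A y′) (q′ ^ b) (y′ ^ m) ⟩
        nCb * (½ * G) ∎

      cross-multiplied : nCb * (½ * G) * ℕ→ℚ m ≡ K * G * (nC[1+b] * q′ ^ suc b * y′ ^ (n ℕ.∸ suc b)) * ℕ→ℚ m
      cross-multiplied = begin
        nCb * (½ * G) * ℕ→ℚ m
          ≡⟨ solve 3 (λ c γ μ → c :* (con ½ :* γ) :* μ := con ½ :* γ :* (μ :* c)) refl nCb G (ℕ→ℚ m) ⟩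
        ½ * G * (ℕ→ℚ m * nCb)
          ≡⟨ cong (½ * G *_) (binomial-absorption n b) ⟩
        ½ * G * (ℕ→ℚ (suc b) * nC[1+b])
          ≡⟨ solve 4 (λ h γ β c → h :* γ :* (β :* c) := h :* β :* γ :* c) refl ½ G (ℕ→ℚ (suc b)) nC[1+b] ⟩
        ½ * ℕ→ℚ (suc b) * G * nC[1+b]
          ≡⟨ cong (λ t → t * G * nC[1+b]) (sym K*W′*m≡½*[1+b]) ⟩
        K * W′ * ℕ→ℚ m * G * nC[1+b]
          ≡⟨ solve 6 (λ κ x z μ γ c → κ :* (x :* z) :* μ :* γ :* c := κ :* γ :* (c :* x :* z) :* μ)
                   refl K (q′ ^ suc b) (y′ ^ (n ℕ.∸ suc b)) (ℕ→ℚ m) G nC[1+b] ⟩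
        K * G * (nC[1+b] * q′ ^ suc b * y′ ^ (n ℕ.∸ suc b)) * ℕ→ℚ m ∎

      pmf≢0 : nC[1+b] * q′ ^ suc b * y′ ^ (n ℕ.∸ suc b) ≢ 0ℚ
      pmf≢0 = subst (_≢ 0ℚ) (sym (*-assoc nC[1+b] (q′ ^ suc b) (y′ ^ (n ℕ.∸ suc b)))) (p*q≢0 nC[1+b]≢0 W′≢0)
        where
        nC[1+b]≢0 : nC[1+b] ≢ 0ℚ
        nC[1+b]≢0 = p*q≢0⇒q≢0 {ℕ→ℚ (suc b)} (subst (_≢ 0ℚ) (binomial-absorption n b) (p*q≢0 m≢0 nCb≢0))
        W′≢0 : W′ ≢ 0ℚ
        W′≢0 = p*q≢0⇒q≢0 {K} (p*q≢0⇒p≢0 {K * W′} {ℕ→ℚ m}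
          (λ eq → p*q≢0 ½≢0 (ℕ→ℚ[1+n]≢0 b) (trans (sym K*W′*m≡½*[1+b]) eq)))

      y′≡X : y′ ≡ X
      y′≡X = trans (1-c//n≡[n∸c]//n b<n n≢0) (cong (λ t → ℕ→ℚ t // ℕ→ℚ n) (sym m′≡n∸1+b))

    zbn-difference : zbn (suc b) n - zbn b n
      ≡ K * ((0ℚ - ℕ→ℚ 2 * q′ ^ b * X ^ m) + ℕ→ℚ b * E′ - ℕ→ℚ b * R₁ * R₂ * E)
    zbn-difference = trans (cong₂ _-_ zbn-at-1+b zbn-at-b)
      (solve 3 (λ κ γ η → κ :* γ :- κ :* η := κ :* (γ :- η))
               refl K ((0ℚ - ℕ→ℚ 2 * q′ ^ b * X ^ m) + ℕ→ℚ b * E′) (ℕ→ℚ b * R₁ * R₂ * E))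

claim1 : (n b : ℕ) → 1 ≤ b → b ≤ n →
  -- first two identities (1 ≤ b ≤ n)
  (pbn b n ≡ ∫ (gPoly b n) 0ℚ (1ℚ - ℕ→ℚ b // ℕ→ℚ n) // ∫ (gPoly b n) 0ℚ 1ℚ)
  × (zbn b n ≡
      ((1ℚ // ℕ→ℚ 2) * ℕ→ℚ b
         * (∫ (gPoly b n) (1ℚ - ℕ→ℚ b // ℕ→ℚ n) 1ℚ
            - ∫ (gPoly b n) 0ℚ (1ℚ - ℕ→ℚ b // ℕ→ℚ n)))
      // (((ℕ→ℚ b // ℕ→ℚ n) ^ b) * ((1ℚ - ℕ→ℚ b // ℕ→ℚ n) ^ (n ℕ.∸ b))))
  -- difference identities (1 ≤ b ≤ n - 1)
  × (suc b ≤ n →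
      (pbn (suc b) n - pbn b n ≡
        ((((ℕ→ℚ (suc b) // ℕ→ℚ n) ^ b) * ((1ℚ - ℕ→ℚ (suc b) // ℕ→ℚ n) ^ (n ℕ.∸ b)))
          - ℕ→ℚ b * ∫ (gPoly b n) (1ℚ - ℕ→ℚ (suc b) // ℕ→ℚ n) (1ℚ - ℕ→ℚ b // ℕ→ℚ n))
        // (ℕ→ℚ b * ∫ (gPoly b n) 0ℚ 1ℚ))
      × (zbn (suc b) n - zbn b n ≡
        ((ℕ→ℚ n ^ n)
          // (ℕ→ℚ 2 * ℕ→ℚ (n ℕ.∸ b) * (ℕ→ℚ (suc b) ^ b) * (ℕ→ℚ (n ℕ.∸ b ℕ.∸ 1) ^ (n ℕ.∸ b ℕ.∸ 1))))
        * ((0ℚ - ℕ→ℚ 2 * ((ℕ→ℚ (suc b) // ℕ→ℚ n) ^ b)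
                      * ((ℕ→ℚ (n ℕ.∸ b ℕ.∸ 1) // ℕ→ℚ n) ^ (n ℕ.∸ b)))
           + ℕ→ℚ b * (∫ (gPoly b n) (1ℚ - ℕ→ℚ (suc b) // ℕ→ℚ n) 1ℚ
                      - ∫ (gPoly b n) 0ℚ (1ℚ - ℕ→ℚ (suc b) // ℕ→ℚ n))
           - ℕ→ℚ b * ((1ℚ + 1ℚ // ℕ→ℚ b) ^ b)
                   * ((1ℚ - 1ℚ // ℕ→ℚ (n ℕ.∸ b)) ^ (n ℕ.∸ b ℕ.∸ 1))
                   * (∫ (gPoly b n) (1ℚ - ℕ→ℚ b // ℕ→ℚ n) 1ℚ
                      - ∫ (gPoly b n) 0ℚ (1ℚ - ℕ→ℚ b // ℕ→ℚ n)))))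
claim1 n (suc k) (s≤s z≤n) b≤n =
  pbn-as-∫ n k b≤n , zbn-as-∫ n k b≤n , λ b<n → pbn-difference n k b≤n , zbn-difference n k b≤n b<n
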